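{- Let $r$ and $m$ be positive integers. Then $\kappa_r(m)=0$ if and only if $m=\sum_{i=t}^{r}\binom{2i-1}{i}$ for some integer $t$ with $1\le t\le r$.
   Context: Every nonnegative integer $m$ has a unique $r$-binomial representation $m=\sum_{i=t}^{r}\binom{a_i}{i}$ with $a_r>a_{r-1}>\dots>a_t\ge t\ge1$. The Kruskal–Katona function is $\kappa_r(m):=\sum_{i=t}^{r}\binom{a_i}{i-1}-m$ (equal to $|\Delta F_{n,r}(m)|-m$ whenever $m\le\binom nr$, where $F_{n,r}(m)$ is the family of the first $m$ $r$-subsets of $\{1,\dots,n\}$ in squashed order and $\Delta$ is the shadow). -}

module Defs where

open import Data.Nat using (ℕ; zero; suc; _+_; _*_; _∸_; _≤?_)
open import Data.Nat.Combinatorics using (_C_)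
open import Data.Integer using (ℤ; +_; _-_)
open import Data.Product using (_×_; _,_)
open import Data.List using (List; []; _∷_; map)
open import Data.Nat.ListAction using (sum)
open import Relation.Nullary using (yes; no)

largestBelow : ℕ → ℕ → ℕ → ℕ
largestBelow r m zero = zero
largestBelow r m (suc n) with (suc n) C r ≤? m
... | yes _ = suc n
... | no  _ = largestBelow r m n

-- The r-binomial representation  m = Σ_{i=t}^{r} (a_i C i),
-- a_r > a_{r-1} > ... > a_t ≥ t ≥ 1, computed greedily:
-- a_r is the largest a with (a C r) ≤ m, then recurse on m ∸ (a_r C r)
-- with r-1, stopping as soon as the remainder is 0.
-- (For r ≥ 1 and m ≥ 1 the largest such a lies in [r, m + r].)
-- The result is the list of pairs (i , a_i) for i = r, r-1, ..., t.
binRep : ℕ → ℕ → List (ℕ × ℕ)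
binRep zero m = []
binRep (suc k) zero = []
binRep (suc k) (suc m) =
  (suc k , a) ∷ binRep k (suc m ∸ (a C suc k))
  where
  a : ℕ
  a = largestBelow (suc k) (suc m) (suc m + suc k)

κ : ℕ → ℕ → ℤ
κ r m = + sum (map (λ { (i , a) → a C (i ∸ 1) }) (binRep r m)) - + m

sumOdd : ℕ → ℕ → ℕ
sumOdd t zero = zero
sumOdd t (suc r) with t ≤? suc r
... | yes _ = ((2 * suc r ∸ 1) C suc r) + sumOdd t r
... | no  _ = sumOdd t r

module Submission where

-- Writing m = Σ C(a_i, i), the Kruskal–Katona function is κ_r(m) = Σ (C(a_i, i-1) - C(a_i, i)),
-- a sum of "excesses". For fixed i the excess of C(a, i) is positive for i-1 ≤ a ≤ 2i-2,
-- vanishes at a = 2i-1 (symmetry of the middle of Pascal's triangle) and is negative for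
-- a ≥ 2i.  Pascal's rule for the excess bounds what the tail of a representation can
-- contribute: if a_r ≤ 2r-2 the total is positive and if a_r ≥ 2r it is negative.  Hence
-- κ_r(m) = 0 forces a_r = 2r-1, and inductively every a_i = 2i-1.  Conversely the chain
-- a_i = 2i-1 (t ≤ i ≤ r) is a representation with zero excess, and representations are unique.

open import Defs
open import Data.Nat using (ℕ; zero; suc; _+_; _∸_; _≤_; _<_; z≤n; s≤s; _≤?_)
import Data.Nat.Properties as ℕ
open import Data.Nat.Combinatorics using (_C_; nCn≡1; nC1≡n; nCk≡nC[n∸k]; k>n⇒nCk≡0)
  renaming (nCk+nC[k+1]≡[n+1]C[k+1] to pascal)
open import Data.Integer using (ℤ; +_; 0ℤ; 1ℤ; -1ℤ; +≤+; -≤+; -≤-; +<+; -<+)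
  renaming (_+_ to _+ℤ_; _-_ to _-ℤ_; -_ to negℤ; _≤_ to _≤ℤ_)
import Data.Integer.Properties as ℤ
open import Algebra.Properties.AbelianGroup ℤ.+-0-abelianGroup using (inverseˡ-unique)
open import Data.Integer.Tactic.RingSolver using (solve-∀)
open import Data.List using (List; []; _∷_; map)
open import Data.Nat.ListAction using (sum)
open import Data.Product using (_×_; _,_; proj₁; proj₂; ∃-syntax)
open import Data.Sum using (_⊎_; inj₁; inj₂)
import Data.Sum as Sum
open import Data.Empty using (⊥-elim)
open import Relation.Nullary using (yes; no)
open import Relation.Binary.Definitions using (tri<; tri≈; tri>)
open import Relation.Binary.PropositionalEquality
open import Function.Bundles using (_⇔_; mk⇔)

1≤nCk : ∀ {n k} → k ≤ n → 1 ≤ n C k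
1≤nCk {zero}  {zero}  _         = s≤s z≤n
1≤nCk {suc n} {zero}  _         = s≤s z≤n
1≤nCk {suc n} {suc k} (s≤s k≤n) =
  subst (1 ≤_) (pascal n k) (ℕ.≤-trans (1≤nCk k≤n) (ℕ.m≤m+n (n C k) (n C suc k)))

nCk≤[1+n]Ck : ∀ n k → n C k ≤ suc n C k
nCk≤[1+n]Ck n zero    = ℕ.≤-refl
nCk≤[1+n]Ck n (suc k) = subst (n C suc k ≤_) (pascal n k) (ℕ.m≤n+m (n C suc k) (n C k))

C-monoˡ-≤ : ∀ k {m n} → m ≤ n → m C k ≤ n C k
C-monoˡ-≤ k {n = zero}  z≤n   = ℕ.≤-refl
C-monoˡ-≤ k {n = suc n} m≤1+n with ℕ.m≤n⇒m<n∨m≡n m≤1+n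
... | inj₁ m<1+n = ℕ.≤-trans (C-monoˡ-≤ k (ℕ.≤-pred m<1+n)) (nCk≤[1+n]Ck n k)
... | inj₂ refl  = ℕ.≤-refl

n<[n+1+k]C[1+k] : ∀ k n → n < (n + suc k) C suc k
n<[n+1+k]C[1+k] k zero    = ℕ.≤-reflexive (sym (nCn≡1 (suc k)))
n<[n+1+k]C[1+k] k (suc n) = subst (suc (suc n) ≤_) (pascal (n + suc k) k)
  (ℕ.+-mono-≤ (1≤nCk (ℕ.≤-trans (ℕ.n≤1+n k) (ℕ.m≤n+m (suc k) n))) (n<[n+1+k]C[1+k] k n))

[k+1+k]Ck≡[k+1+k]C[1+k] : ∀ k → (k + suc k) C k ≡ (k + suc k) C suc k
[k+1+k]Ck≡[k+1+k]C[1+k] k =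
  trans (nCk≡nC[n∸k] (ℕ.m≤m+n k (suc k))) (cong ((k + suc k) C_) (ℕ.m+n∸m≡n k (suc k)))

k+k≤k+[1+k] : ∀ k → k + k ≤ k + suc k
k+k≤k+[1+k] k = ℕ.+-monoʳ-≤ k (ℕ.n≤1+n k)

i≤i+j : ∀ i {j} → 0ℤ ≤ℤ j → i ≤ℤ i +ℤ j
i≤i+j i 0≤j = ℤ.≤-trans (ℤ.≤-reflexive (sym (ℤ.+-identityʳ i))) (ℤ.+-monoʳ-≤ i 0≤j)

i+j≤i : ∀ i {j} → j ≤ℤ 0ℤ → i +ℤ j ≤ℤ i
i+j≤i i j≤0 = ℤ.≤-trans (ℤ.+-monoʳ-≤ i j≤0) (ℤ.≤-reflexive (ℤ.+-identityʳ i))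

-- excess i a = C(a, i-1) - C(a, i) is what the term C(a, i) contributes to κ.  At i = 0 it
-- follows the convention C(a, -1) = 0, which keeps excess-pascal valid there.
excess : ℕ → ℕ → ℤ
excess zero    a = -1ℤ
excess (suc i) a = + (a C i) -ℤ + (a C suc i)

excess-pascal : ∀ i a → excess (suc i) (suc a) ≡ excess (suc i) a +ℤ excess i a
excess-pascal zero a rewrite nC1≡n (suc a) | nC1≡n a =
  trans (cong (1ℤ -ℤ_) (ℤ.pos-+ 1 a)) (shift (+ a))
  where
  shift : ∀ (x : ℤ) → 1ℤ -ℤ (1ℤ +ℤ x) ≡ (1ℤ -ℤ x) +ℤ -1ℤ
  shift = solve-∀
excess-pascal (suc i) a =
  begin
    + (suc a C suc i) -ℤ + (suc a C suc (suc i))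
  ≡⟨ cong₂ (λ u v → + u -ℤ + v) (sym (pascal a i)) (sym (pascal a (suc i))) ⟩
    + (a C i + a C suc i) -ℤ + (a C suc i + a C suc (suc i))
  ≡⟨ cong₂ _-ℤ_ (ℤ.pos-+ (a C i) _) (ℤ.pos-+ (a C suc i) _) ⟩
    (+ (a C i) +ℤ + (a C suc i)) -ℤ (+ (a C suc i) +ℤ + (a C suc (suc i)))
  ≡⟨ regroup (+ (a C i)) (+ (a C suc i)) (+ (a C suc (suc i))) ⟩
    excess (suc (suc i)) a +ℤ excess (suc i) a
  ∎
  where
  open ≡-Reasoning
  regroup : ∀ (x y z : ℤ) → (x +ℤ y) -ℤ (y +ℤ z) ≡ (y -ℤ z) +ℤ (x -ℤ y)
  regroup = solve-∀

excess-middle≡0 : ∀ k → excess (suc k) (k + suc k) ≡ 0ℤ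
excess-middle≡0 k =
  trans (cong (λ c → + c -ℤ + ((k + suc k) C suc k)) ([k+1+k]Ck≡[k+1+k]C[1+k] k))
        (ℤ.+-inverseʳ (+ ((k + suc k) C suc k)))

excess-nonneg : ∀ s a → a < s + s → 0ℤ ≤ℤ excess s a
excess-nonneg (suc k) zero _ rewrite k>n⇒nCk≡0 {0} {suc k} (s≤s z≤n) = +≤+ z≤n
excess-nonneg (suc k) (suc a) (s≤s 1+a≤2k+1) with ℕ.m≤n⇒m<n∨m≡n 1+a≤2k+1
... | inj₂ 1+a≡2k+1 =
  subst (λ x → 0ℤ ≤ℤ excess (suc k) x) (sym 1+a≡2k+1) (ℤ.≤-reflexive (sym (excess-middle≡0 k)))
... | inj₁ 2+a≤2k+1 = subst (0ℤ ≤ℤ_) (sym (excess-pascal k a))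
  (ℤ.+-mono-≤ (excess-nonneg (suc k) a (ℕ.<-trans (ℕ.n<1+n a) (s≤s 1+a≤2k+1)))
              (excess-nonneg k a (ℕ.≤-pred (subst (suc (suc a) ≤_) (ℕ.+-suc k k) 2+a≤2k+1))))

excess-pos : ∀ k a → k ≤ a → a ≤ k + k → 1ℤ ≤ℤ excess (suc k) a
excess-pos k a k≤a _ with ℕ.m≤n⇒m<n∨m≡n k≤a
excess-pos k k _ _ | inj₂ refl rewrite nCn≡1 k | k>n⇒nCk≡0 (ℕ.n<1+n k) = ℤ.≤-refl
excess-pos k (suc a) _ 1+a≤2k | inj₁ (s≤s k≤a) = subst (1ℤ ≤ℤ_) (sym (excess-pascal k a))
  (ℤ.≤-trans (excess-pos k a k≤a (ℕ.<⇒≤ 1+a≤2k))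
             (i≤i+j (excess (suc k) a) (excess-nonneg k a 1+a≤2k)))

excess≤-1 : ∀ s a → s + s ≤ a → excess s a ≤ℤ -1ℤ
excess≤-1 zero    a       _ = ℤ.≤-refl
excess≤-1 (suc k) (suc a) (s≤s 2k+1≤a) with ℕ.m≤n⇒m<n∨m≡n 2k+1≤a
... | inj₂ refl = begin
    excess (suc k) (suc (k + suc k))                    ≡⟨ excess-pascal k (k + suc k) ⟩
    excess (suc k) (k + suc k) +ℤ excess k (k + suc k)  ≡⟨ cong (_+ℤ excess k (k + suc k)) (excess-middle≡0 k) ⟩
    0ℤ +ℤ excess k (k + suc k)                          ≡⟨ ℤ.+-identityˡ (excess k (k + suc k)) ⟩
    excess k (k + suc k)                                ≤⟨ excess≤-1 k _ (k+k≤k+[1+k] k) ⟩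
    -1ℤ                                                 ∎
  where open ℤ.≤-Reasoning
... | inj₁ 2k+2≤a = begin
    excess (suc k) (suc a)              ≡⟨ excess-pascal k a ⟩
    excess (suc k) a +ℤ excess k a      ≤⟨ ℤ.+-mono-≤ (excess≤-1 (suc k) a 2k+2≤a)
                                             (excess≤-1 k a (ℕ.≤-trans (k+k≤k+[1+k] k) (ℕ.<⇒≤ 2k+2≤a))) ⟩
    -1ℤ +ℤ -1ℤ                          ≤⟨ -≤- z≤n ⟩
    -1ℤ                                 ∎
  where open ℤ.≤-Reasoning

excess-mono-≤ : ∀ k {a b} → a ≤ b → b ≤ k + k → excess (suc k) a ≤ℤ excess (suc k) b
excess-mono-≤ k {b = zero}  z≤n _ = ℤ.≤-refl
excess-mono-≤ k {a} {suc b} a≤1+b 1+b≤2k with ℕ.m≤n⇒m<n∨m≡n a≤1+b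
... | inj₂ refl  = ℤ.≤-refl
... | inj₁ a<1+b = subst (excess (suc k) a ≤ℤ_) (sym (excess-pascal k b))
  (ℤ.≤-trans (excess-mono-≤ k (ℕ.≤-pred a<1+b) (ℕ.<⇒≤ 1+b≤2k))
             (i≤i+j (excess (suc k) b) (excess-nonneg k b 1+b≤2k)))

excess-antimono-≤ : ∀ s {a b} → s + s ≤ suc a → a ≤ b → excess s b ≤ℤ excess s a
excess-antimono-≤ zero    _ _ = ℤ.≤-refl
excess-antimono-≤ (suc k) {b = zero}  _ z≤n = ℤ.≤-refl
excess-antimono-≤ (suc k) {a} {suc b} 2k+2≤1+a a≤1+b with ℕ.m≤n⇒m<n∨m≡n a≤1+b
... | inj₂ refl  = ℤ.≤-refl
... | inj₁ a<1+b = subst (_≤ℤ excess (suc k) a) (sym (excess-pascal k b))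
  (ℤ.≤-trans (i+j≤i (excess (suc k) b) (ℤ.≤-trans (excess≤-1 k b 2k≤b) -≤+))
             (excess-antimono-≤ (suc k) 2k+2≤1+a (ℕ.≤-pred a<1+b)))
  where
  2k≤b : k + k ≤ b
  2k≤b = ℕ.≤-trans (k+k≤k+[1+k] k) (ℕ.≤-trans (ℕ.≤-pred 2k+2≤1+a) (ℕ.≤-pred a<1+b))

excess-antimono-< : ∀ k {a b} → k + suc k ≤ a → a < b →
                    excess (suc k) b +ℤ 1ℤ ≤ℤ excess (suc k) a
excess-antimono-< k {a} {suc b} 2k+1≤a (s≤s a≤b) = begin
  excess (suc k) (suc b) +ℤ 1ℤ              ≡⟨ cong (_+ℤ 1ℤ) (excess-pascal k b) ⟩
  excess (suc k) b +ℤ excess k b +ℤ 1ℤ      ≡⟨ ℤ.+-assoc (excess (suc k) b) (excess k b) 1ℤ ⟩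
  excess (suc k) b +ℤ (excess k b +ℤ 1ℤ)    ≤⟨ i+j≤i (excess (suc k) b)
                                                 (ℤ.+-monoˡ-≤ 1ℤ (excess≤-1 k b 2k≤b)) ⟩
  excess (suc k) b                          ≤⟨ excess-antimono-≤ (suc k) (s≤s 2k+1≤a) a≤b ⟩
  excess (suc k) a                          ∎
  where
  open ℤ.≤-Reasoning
  2k≤b : k + k ≤ b
  2k≤b = ℕ.≤-trans (k+k≤k+[1+k] k) (ℕ.≤-trans 2k+1≤a a≤b)

excess-[2k]≡-excess : ∀ k → excess (suc k) (k + k) ≡ negℤ (excess k (k + k))
excess-[2k]≡-excess k = inverseˡ-unique (excess (suc k) (k + k)) (excess k (k + k)) (begin
  excess (suc k) (k + k) +ℤ excess k (k + k)  ≡⟨ excess-pascal k (k + k) ⟨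
  excess (suc k) (suc (k + k))                ≡⟨ cong (excess (suc k)) (ℕ.+-suc k k) ⟨
  excess (suc k) (k + suc k)                  ≡⟨ excess-middle≡0 k ⟩
  0ℤ                                          ∎)
  where open ≡-Reasoning

-- excess (suc k) rises up to a = 2k and falls afterwards; its peak value is −excess k 2k.
excess≤-excess[2k+2] : ∀ k b → excess (suc k) b ≤ℤ negℤ (excess k (suc k + suc k))
excess≤-excess[2k+2] k b with b ≤? k + k
... | yes b≤2k = begin
  excess (suc k) b                  ≤⟨ excess-mono-≤ k b≤2k ℕ.≤-refl ⟩
  excess (suc k) (k + k)            ≡⟨ excess-[2k]≡-excess k ⟩
  negℤ (excess k (k + k))           ≤⟨ ℤ.neg-mono-≤ (excess-antimono-≤ k (ℕ.n≤1+n (k + k))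
                                         (ℕ.m≤n⇒m≤1+n (k+k≤k+[1+k] k))) ⟩
  negℤ (excess k (suc k + suc k))   ∎
  where open ℤ.≤-Reasoning
... | no b≰2k = begin
  excess (suc k) b                  ≤⟨ excess-antimono-≤ (suc k) ℕ.≤-refl 2k+1≤b ⟩
  excess (suc k) (k + suc k)        ≡⟨ excess-middle≡0 k ⟩
  0ℤ                                ≤⟨ +≤+ z≤n ⟩
  1ℤ                                ≤⟨ ℤ.neg-mono-≤ (excess≤-1 k (suc k + suc k)
                                         (ℕ.m≤n⇒m≤1+n (k+k≤k+[1+k] k))) ⟩
  negℤ (excess k (suc k + suc k))   ∎
  where
  open ℤ.≤-Reasoning
  2k+1≤b : k + suc k ≤ b
  2k+1≤b = subst (_≤ b) (sym (ℕ.+-suc k k)) (ℕ.≰⇒> b≰2k)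

excess-[2k+4]≡ : ∀ k → excess (suc (suc k)) (suc (suc k) + suc (suc k)) ≡
                       excess (suc k) (suc k + suc k) +ℤ excess k (suc k + suc k)
excess-[2k+4]≡ k = begin
  excess (suc (suc k)) (suc (suc k + suc (suc k)))
    ≡⟨ excess-pascal (suc k) (suc k + suc (suc k)) ⟩
  excess (suc (suc k)) (suc k + suc (suc k)) +ℤ excess (suc k) (suc k + suc (suc k))
    ≡⟨ cong (_+ℤ excess (suc k) (suc k + suc (suc k))) (excess-middle≡0 (suc k)) ⟩
  0ℤ +ℤ excess (suc k) (suc k + suc (suc k))
    ≡⟨ ℤ.+-identityˡ _ ⟩
  excess (suc k) (suc k + suc (suc k))
    ≡⟨ cong (excess (suc k)) (ℕ.+-suc (suc k) (suc k)) ⟩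
  excess (suc k) (suc (suc k + suc k))
    ≡⟨ excess-pascal k (suc k + suc k) ⟩
  excess (suc k) (suc k + suc k) +ℤ excess k (suc k + suc k)
    ∎
  where open ≡-Reasoning

excess-dichotomy : ∀ k {c a} → c ≤ a →
                   0ℤ ≤ℤ excess (suc k) c ⊎ excess (suc k) a ≤ℤ excess (suc k) c
excess-dichotomy k {c} c≤a with c ≤? k + suc k
... | yes c≤2k+1 = inj₁ (excess-nonneg (suc k) c (s≤s c≤2k+1))
... | no  c≰2k+1 = inj₂ (excess-antimono-≤ (suc k) (ℕ.m≤n⇒m≤1+n (ℕ.≰⇒> c≰2k+1)) c≤a)

excess-dichotomy-< : ∀ k {c a} → c < a →
                     0ℤ ≤ℤ excess (suc k) c ⊎ excess (suc k) a +ℤ 1ℤ ≤ℤ excess (suc k) c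
excess-dichotomy-< k {c} c<a with c ≤? k + suc k
... | yes c≤2k+1 = inj₁ (excess-nonneg (suc k) c (s≤s c≤2k+1))
... | no  c≰2k+1 = inj₂ (excess-antimono-< k (ℕ.<⇒≤ (ℕ.≰⇒> c≰2k+1)) c<a)

excess-pascal-≤ : ∀ k b {x} → excess k b +ℤ 1ℤ ≤ℤ x →
                  excess (suc k) (suc b) +ℤ 1ℤ ≤ℤ excess (suc k) b +ℤ x
excess-pascal-≤ k b {x} ≤x = begin
  excess (suc k) (suc b) +ℤ 1ℤ             ≡⟨ cong (_+ℤ 1ℤ) (excess-pascal k b) ⟩
  excess (suc k) b +ℤ excess k b +ℤ 1ℤ     ≡⟨ ℤ.+-assoc (excess (suc k) b) (excess k b) 1ℤ ⟩
  excess (suc k) b +ℤ (excess k b +ℤ 1ℤ)   ≤⟨ ℤ.+-monoʳ-≤ (excess (suc k) b) ≤x ⟩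
  excess (suc k) b +ℤ x                    ∎
  where open ℤ.≤-Reasoning

Repr : Set
Repr = List (ℕ × ℕ)

value shadow : Repr → ℕ
value  []            = 0
value  ((i , a) ∷ l) = a C i + value l
shadow []            = 0
shadow ((i , a) ∷ l) = a C (i ∸ 1) + shadow l

totalExcess : Repr → ℤ
totalExcess []            = 0ℤ
totalExcess ((i , a) ∷ l) = excess i a +ℤ totalExcess l

-- BinRep s a l : l = [(s , a_s), (s-1 , a_{s-1}), …, (t , a_t)] with a > a_s > … > a_t ≥ t ≥ 1,
-- or l = [] ; that is, an s-binomial representation all of whose a_i lie below a.
data BinRep : ℕ → ℕ → Repr → Set where
  nil  : ∀ {s a} → BinRep s a []
  cons : ∀ {k a b l} → b < a → suc k ≤ b → BinRep k b l → BinRep (suc k) a ((suc k , b) ∷ l)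

totalExcess≡shadow-value : ∀ {s a l} → BinRep s a l → totalExcess l ≡ + shadow l -ℤ + value l
totalExcess≡shadow-value nil = refl
totalExcess≡shadow-value (cons {k} {b = b} {l} _ _ rep) = begin
  excess (suc k) b +ℤ totalExcess l
    ≡⟨ cong (excess (suc k) b +ℤ_) (totalExcess≡shadow-value rep) ⟩
  (+ (b C k) -ℤ + (b C suc k)) +ℤ (+ shadow l -ℤ + value l)
    ≡⟨ regroup (+ (b C k)) (+ (b C suc k)) (+ shadow l) (+ value l) ⟩
  (+ (b C k) +ℤ + shadow l) -ℤ (+ (b C suc k) +ℤ + value l)
    ≡⟨ cong₂ _-ℤ_ (ℤ.pos-+ (b C k) (shadow l)) (ℤ.pos-+ (b C suc k) (value l)) ⟨
  + (b C k + shadow l) -ℤ + (b C suc k + value l)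
    ∎
  where
  open ≡-Reasoning
  regroup : ∀ (p q x y : ℤ) → (p -ℤ q) +ℤ (x -ℤ y) ≡ (p +ℤ x) -ℤ (q +ℤ y)
  regroup = solve-∀

-- The pattern-matching lambda inside κ cannot be named here, hence the pointwise hypothesis.
κ≡shadow-m : ∀ r m → κ r m ≡ + shadow (binRep r m) -ℤ + m
κ≡shadow-m r m = cong (λ n → + n -ℤ + m) (sum-map≡shadow _ (λ _ _ → refl) (binRep r m))
  where
  sum-map≡shadow : ∀ (g : ℕ × ℕ → ℕ) → (∀ i a → g (i , a) ≡ a C (i ∸ 1)) →
                   ∀ l → sum (map g l) ≡ shadow l
  sum-map≡shadow g g≡ []            = refl
  sum-map≡shadow g g≡ ((i , a) ∷ l) = cong₂ _+_ (g≡ i a) (sum-map≡shadow g g≡ l)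

κ≡totalExcess : ∀ {r a m} → BinRep r a (binRep r m) → value (binRep r m) ≡ m →
                κ r m ≡ totalExcess (binRep r m)
κ≡totalExcess {r} {m = m} rep value≡m = trans (κ≡shadow-m r m) (sym (trans (totalExcess≡shadow-value rep)
  (cong (λ n → + shadow (binRep r m) -ℤ + n) value≡m)))

largestBelow-C≤ : ∀ k m n → largestBelow (suc k) m n C suc k ≤ m
largestBelow-C≤ k m zero    = z≤n
largestBelow-C≤ k m (suc n) with suc n C suc k ≤? m
... | yes fits = fits
... | no  _    = largestBelow-C≤ k m n

largestBelow-maximal : ∀ s m n {x} → largestBelow s m n < x → x ≤ n → m < x C s
largestBelow-maximal s m zero    lb<x x≤0 = ⊥-elim (ℕ.<⇒≱ lb<x x≤0)
largestBelow-maximal s m (suc n) {x} lb<x x≤1+n with suc n C s ≤? m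
... | yes _ = ⊥-elim (ℕ.<⇒≱ lb<x x≤1+n)
... | no 1+n-misfits with ℕ.m≤n⇒m<n∨m≡n x≤1+n
...   | inj₁ x<1+n = largestBelow-maximal s m n lb<x (ℕ.≤-pred x<1+n)
...   | inj₂ refl  = ℕ.≰⇒> 1+n-misfits

binRep-correct : ∀ s m {a} → m < a C s → BinRep s a (binRep s m) × value (binRep s m) ≡ m
binRep-correct zero    m       m<1 = nil , sym (ℕ.n<1⇒n≡0 m<1)
binRep-correct (suc k) zero    _   = nil , refl
binRep-correct (suc k) (suc m) {a} m<aC =
  cons b<a 1+k≤b (proj₁ rest) ,
  trans (cong (_+_ (b C suc k)) (proj₂ rest)) (ℕ.m+[n∸m]≡n b-fits)
  where
  M bound b : ℕ
  M = suc m
  bound = M + suc k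
  b = largestBelow (suc k) M bound
  b-fits : b C suc k ≤ M
  b-fits = largestBelow-C≤ k M bound
  M<[1+b]C[1+k] : M < suc b C suc k
  M<[1+b]C[1+k] with suc b ≤? bound
  ... | yes 1+b≤bound = largestBelow-maximal (suc k) M bound (ℕ.n<1+n b) 1+b≤bound
  ... | no  1+b≰bound =
    ℕ.<-≤-trans (n<[n+1+k]C[1+k] k M) (C-monoˡ-≤ (suc k) (ℕ.<⇒≤ (ℕ.≰⇒> 1+b≰bound)))
  b<a : b < a
  b<a = ℕ.≰⇒> (λ a≤b → ℕ.<⇒≱ m<aC (ℕ.≤-trans (C-monoˡ-≤ (suc k) a≤b) b-fits))
  1+k≤b : suc k ≤ b
  1+k≤b = ℕ.≮⇒≥ (λ b<1+k → ℕ.<⇒≱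
    (largestBelow-maximal (suc k) M bound b<1+k (ℕ.m≤n+m (suc k) M))
    (subst (_≤ M) (sym (nCn≡1 (suc k))) (s≤s z≤n)))
  remainder<bCk : M ∸ b C suc k < b C k
  remainder<bCk = subst (M ∸ b C suc k <_) (ℕ.m+n∸n≡m (b C k) (b C suc k))
    (ℕ.∸-monoˡ-< (subst (M <_) (sym (pascal b k)) M<[1+b]C[1+k]) b-fits)
  rest : BinRep k b (binRep k (M ∸ b C suc k)) × value (binRep k (M ∸ b C suc k)) ≡ M ∸ b C suc k
  rest = binRep-correct k (M ∸ b C suc k) remainder<bCk

value<C : ∀ {s a l} → BinRep s a l → s ≤ a → value l < a C s
value<C nil s≤a = 1≤nCk s≤a
value<C (cons {k} {a} {b} {l} b<a 1+k≤b rep) _ = begin-strict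
  b C suc k + value l    <⟨ ℕ.+-monoʳ-< (b C suc k) (value<C rep (ℕ.≤-trans (ℕ.n≤1+n k) 1+k≤b)) ⟩
  b C suc k + b C k      ≡⟨ ℕ.+-comm (b C suc k) (b C k) ⟩
  b C k + b C suc k      ≡⟨ pascal b k ⟩
  suc b C suc k          ≤⟨ C-monoˡ-≤ (suc k) b<a ⟩
  a C suc k              ∎
  where open ℕ.≤-Reasoning

0<value-cons : ∀ {k b l} → suc k ≤ b → 0 < value ((suc k , b) ∷ l)
0<value-cons {k} {b} {l} 1+k≤b = ℕ.≤-trans (1≤nCk 1+k≤b) (ℕ.m≤m+n (b C suc k) (value l))

value-cons-< : ∀ {k b b′ l l′} → suc k ≤ b → BinRep k b l → b < b′ →
               value ((suc k , b) ∷ l) < value ((suc k , b′) ∷ l′)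
value-cons-< {k} {b} {b′} {l} {l′} 1+k≤b rep b<b′ = begin-strict
  value ((suc k , b) ∷ l)   <⟨ value<C (cons (ℕ.n<1+n b) 1+k≤b rep) (ℕ.m≤n⇒m≤1+n 1+k≤b) ⟩
  suc b C suc k             ≤⟨ C-monoˡ-≤ (suc k) b<b′ ⟩
  b′ C suc k                ≤⟨ ℕ.m≤m+n (b′ C suc k) (value l′) ⟩
  value ((suc k , b′) ∷ l′) ∎
  where open ℕ.≤-Reasoning

BinRep-unique : ∀ {s a a′ l l′} → BinRep s a l → BinRep s a′ l′ → value l ≡ value l′ → l ≡ l′
BinRep-unique nil nil _ = refl
BinRep-unique nil (cons {l = l′} _ 1+k≤b′ _) v≡v′ = ⊥-elim (ℕ.<⇒≢ (0<value-cons {l = l′} 1+k≤b′) v≡v′)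
BinRep-unique (cons {l = l} _ 1+k≤b _) nil v≡v′ = ⊥-elim (ℕ.<⇒≢ (0<value-cons {l = l} 1+k≤b) (sym v≡v′))
BinRep-unique (cons {k} {b = b} {l} _ 1+k≤b rep) (cons {b = b′} {l′} _ 1+k≤b′ rep′) v≡v′
  with ℕ.<-cmp b b′
... | tri< b<b′ _ _ = ⊥-elim (ℕ.<⇒≢ (value-cons-< {l′ = l′} 1+k≤b rep b<b′) v≡v′)
... | tri> _ _ b′<b = ⊥-elim (ℕ.<⇒≢ (value-cons-< {l′ = l} 1+k≤b′ rep′ b′<b) (sym v≡v′))
... | tri≈ _ refl _ =
  cong ((suc k , b) ∷_) (BinRep-unique rep rep′ (ℕ.+-cancelˡ-≡ (b C suc k) (value l) (value l′) v≡v′))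

totalExcess-lower : ∀ {s a l} → BinRep s a l →
                    0ℤ ≤ℤ totalExcess l ⊎ excess s a +ℤ 1ℤ ≤ℤ totalExcess l
totalExcess-lower nil = inj₁ ℤ.≤-refl
totalExcess-lower (cons {k} {b = b} {l} b<a _ rep) with totalExcess-lower rep
... | inj₁ 0≤T = Sum.map (λ 0≤e → ℤ.+-mono-≤ 0≤e 0≤T)
                         (λ e+1≤e′ → ℤ.≤-trans e+1≤e′ (i≤i+j (excess (suc k) b) 0≤T))
                         (excess-dichotomy-< k b<a)
... | inj₂ e+1≤T = Sum.map (λ 0≤e → ℤ.≤-trans (ℤ.≤-trans 0≤e (i≤i+j _ (+≤+ z≤n))) step)
                           (λ e≤e′ → ℤ.≤-trans (ℤ.+-monoˡ-≤ 1ℤ e≤e′) step)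
                           (excess-dichotomy k b<a)
  where
  step : excess (suc k) (suc b) +ℤ 1ℤ ≤ℤ excess (suc k) b +ℤ totalExcess l
  step = excess-pascal-≤ k b e+1≤T

totalExcess-upper : ∀ {s a l} → BinRep s a l →
                    excess (suc s) (suc s + suc s) +ℤ totalExcess l ≤ℤ -1ℤ
totalExcess-upper {s} nil = subst (_≤ℤ -1ℤ) (sym (ℤ.+-identityʳ _)) (excess≤-1 (suc s) _ ℕ.≤-refl)
totalExcess-upper (cons {k} {b = b} {l} _ _ rep) = begin
  excess (suc (suc k)) (suc (suc k) + suc (suc k)) +ℤ (excess (suc k) b +ℤ totalExcess l)
    ≡⟨ cong (_+ℤ (excess (suc k) b +ℤ totalExcess l)) (excess-[2k+4]≡ k) ⟩
  (x +ℤ y) +ℤ (excess (suc k) b +ℤ totalExcess l)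
    ≤⟨ ℤ.+-monoʳ-≤ (x +ℤ y) (ℤ.+-monoˡ-≤ (totalExcess l) (excess≤-excess[2k+2] k b)) ⟩
  (x +ℤ y) +ℤ (negℤ y +ℤ totalExcess l)
    ≡⟨ cancel x y (totalExcess l) ⟩
  x +ℤ totalExcess l
    ≤⟨ totalExcess-upper rep ⟩
  -1ℤ
    ∎
  where
  open ℤ.≤-Reasoning
  x y : ℤ
  x = excess (suc k) (suc k + suc k)
  y = excess k (suc k + suc k)
  cancel : ∀ (x y z : ℤ) → (x +ℤ y) +ℤ (negℤ y +ℤ z) ≡ x +ℤ z
  cancel = solve-∀

totalExcess-pos : ∀ {k b l} → k ≤ b → b ≤ k + k → BinRep k b l →
                  1ℤ ≤ℤ excess (suc k) b +ℤ totalExcess l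
totalExcess-pos {k} {b} k≤b b≤2k rep with totalExcess-lower rep
... | inj₁ 0≤T   = ℤ.≤-trans (excess-pos k b k≤b b≤2k) (i≤i+j (excess (suc k) b) 0≤T)
... | inj₂ e+1≤T = ℤ.≤-trans (ℤ.+-monoˡ-≤ 1ℤ (excess-nonneg (suc k) (suc b) 2+b≤2k+2))
                             (excess-pascal-≤ k b e+1≤T)
  where
  2+b≤2k+2 : suc b < suc k + suc k
  2+b≤2k+2 = s≤s (subst (suc b ≤_) (sym (ℕ.+-suc k k)) (s≤s b≤2k))

totalExcess-neg : ∀ {k b l} → suc k + suc k ≤ b → BinRep k b l →
                  excess (suc k) b +ℤ totalExcess l ≤ℤ -1ℤ
totalExcess-neg {k} {l = l} 2k+2≤b rep =
  ℤ.≤-trans (ℤ.+-monoˡ-≤ (totalExcess l) (excess-antimono-≤ (suc k) (ℕ.n≤1+n _) 2k+2≤b))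
            (totalExcess-upper rep)

oddChain : ℕ → ℕ → Repr
oddChain t zero = []
oddChain t (suc r) with t ≤? suc r
... | yes _ = (suc r , r + suc r) ∷ oddChain t r
... | no  _ = oddChain t r

oddChain-step : ∀ {t r} → t ≤ suc r → oddChain t (suc r) ≡ (suc r , r + suc r) ∷ oddChain t r
oddChain-step {t} {r} t≤1+r with t ≤? suc r
... | yes _    = refl
... | no  t≰1+r = ⊥-elim (t≰1+r t≤1+r)

oddChain-empty : ∀ {t r} → r < t → oddChain t r ≡ []
oddChain-empty {t} {zero}  _   = refl
oddChain-empty {t} {suc r} r<t with t ≤? suc r
... | yes t≤1+r = ⊥-elim (ℕ.<⇒≱ r<t t≤1+r)
... | no  _     = oddChain-empty (ℕ.<⇒≤ r<t)

value-oddChain : ∀ t r → value (oddChain t r) ≡ sumOdd t r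
value-oddChain t zero = refl
value-oddChain t (suc r) with t ≤? suc r
... | yes _ = cong₂ _+_ (cong (_C suc r) (cong (_+_ r) (sym (ℕ.+-identityʳ (suc r)))))
                        (value-oddChain t r)
... | no  _ = value-oddChain t r

oddChain-BinRep : ∀ t r {a} → r + r ≤ a → BinRep r a (oddChain t r)
oddChain-BinRep t zero    _ = nil
oddChain-BinRep t (suc r) 2r+2≤a with t ≤? suc r
... | yes _ = cons 2r+2≤a (ℕ.m≤n+m (suc r) r) (oddChain-BinRep t r (k+k≤k+[1+k] r))
... | no  t≰1+r rewrite oddChain-empty {t} {r} (ℕ.<-trans (ℕ.n<1+n r) (ℕ.≰⇒> t≰1+r)) = nil

totalExcess-oddChain : ∀ t r → totalExcess (oddChain t r) ≡ 0ℤ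
totalExcess-oddChain t zero = refl
totalExcess-oddChain t (suc r) with t ≤? suc r
... | yes _ = cong₂ _+ℤ_ (excess-middle≡0 r) (totalExcess-oddChain t r)
... | no  _ = totalExcess-oddChain t r

totalExcess≡0⇒oddChain : ∀ {s a l} → BinRep s a l → totalExcess l ≡ 0ℤ →
                         ∃[ t ] ((1 ≤ t × t ≤ suc s) × l ≡ oddChain t s)
totalExcess≡0⇒oddChain {s} nil _ = suc s , (s≤s z≤n , ℕ.≤-refl) , sym (oddChain-empty (ℕ.n<1+n s))
totalExcess≡0⇒oddChain (cons {k} {b = b} {l} _ 1+k≤b rep) T≡0 with ℕ.<-cmp b (k + suc k)
... | tri< b<2k+1 _ _ = ⊥-elim (ℤ.≤⇒≯
  (subst (1ℤ ≤ℤ_) T≡0 (totalExcess-pos (ℕ.≤-trans (ℕ.n≤1+n k) 1+k≤b) b≤2k rep)) (+<+ (s≤s z≤n)))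
  where
  b≤2k : b ≤ k + k
  b≤2k = ℕ.≤-pred (subst (suc b ≤_) (ℕ.+-suc k k) b<2k+1)
... | tri> _ _ 2k+1<b = ⊥-elim (ℤ.≤⇒≯ (subst (_≤ℤ -1ℤ) T≡0 (totalExcess-neg 2k+1<b rep)) -<+)
... | tri≈ _ refl _ with totalExcess≡0⇒oddChain rep tail≡0
  where
  tail≡0 : totalExcess l ≡ 0ℤ
  tail≡0 = trans (sym (ℤ.+-identityˡ (totalExcess l)))
                 (trans (cong (_+ℤ totalExcess l) (sym (excess-middle≡0 k))) T≡0)
...   | t , (1≤t , t≤1+k) , l≡chain =
  t , (1≤t , ℕ.m≤n⇒m≤1+n t≤1+k) ,
  trans (cong ((suc k , k + suc k) ∷_) l≡chain) (sym (oddChain-step t≤1+k))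

corollary3p7 : (r m : ℕ) → 0 < r → 0 < m →
    (κ r m ≡ 0ℤ) ⇔ (∃[ t ] ((1 ≤ t × t ≤ r) × m ≡ sumOdd t r))
corollary3p7 r@(suc k) m _ 0<m = mk⇔ to from
  where
  l : Repr
  l = binRep r m
  correct : BinRep r (m + r) l × value l ≡ m
  correct = binRep-correct r m (n<[n+1+k]C[1+k] k m)
  rep : BinRep r (m + r) l
  rep = proj₁ correct
  m≡value : ∀ {l′} → l ≡ l′ → m ≡ value l′
  m≡value l≡l′ = trans (sym (proj₂ correct)) (cong value l≡l′)

  to : κ r m ≡ 0ℤ → ∃[ t ] ((1 ≤ t × t ≤ r) × m ≡ sumOdd t r)
  to κ≡0 with totalExcess≡0⇒oddChain rep (trans (sym (κ≡totalExcess rep (proj₂ correct))) κ≡0)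
  ... | t , (1≤t , _) , l≡chain = t , (1≤t , t≤r) , trans (m≡value l≡chain) (value-oddChain t r)
    where
    t≤r : t ≤ r
    t≤r = ℕ.≮⇒≥ (λ r<t → ℕ.<⇒≢ 0<m (sym (m≡value (trans l≡chain (oddChain-empty r<t)))))

  from : ∃[ t ] ((1 ≤ t × t ≤ r) × m ≡ sumOdd t r) → κ r m ≡ 0ℤ
  from (t , _ , m≡sum) = begin
    κ r m                           ≡⟨ κ≡totalExcess rep (proj₂ correct) ⟩
    totalExcess l                   ≡⟨ cong totalExcess (BinRep-unique rep (oddChain-BinRep t r ℕ.≤-refl)
                                         (trans (proj₂ correct) (trans m≡sum (sym (value-oddChain t r))))) ⟩
    totalExcess (oddChain t r)      ≡⟨ totalExcess-oddChain t r ⟩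
    0ℤ                              ∎
    where open ≡-Reasoning
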